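{- Let $\overrightarrow{G}$ be a 2-qBMG satisfying at least one of the following conditions: ($*$) no two symmetric edges of $\overrightarrow{G}$ have a common endpoint; ($**$) no two vertices of $\overrightarrow{G}$ are equivalent. Fix an orientation $\overrightarrow{\Gamma}$ of $\overrightarrow{G}$. Let $\overrightarrow{\Delta}$ be an induced subgraph of $\overrightarrow{\Gamma}$ whose underlying undirected graph $\Delta$ is a biclique of the underlying undirected graph $G$ of $\overrightarrow{G}$. If $\overrightarrow{G}$ has no symmetric edges with both endpoints in $\overrightarrow{\Delta}$, then $\overrightarrow{\Delta}$ is a 2-qBMG.
   Context: A two-color quasi best match graph (2-qBMG) is a bipartite directed graph $\overrightarrow{G}$ (vertex set split into two color classes, every edge joining vertices of different colors) without loops and parallel edges, satisfying: (N1) if $u$ and $v$ are two independent (non-adjacent) vertices then there exist no vertices $w,t$ such that $ut, vw, tw$ are edges; (N2) if $uv, vw, wt$ are edges then $ut$ is an edge; (N3) if $u$ and $v$ have a common out-neighbor then either every out-neighbor of $u$ is an out-neighbor of $v$ or every out-neighbor of $v$ is an out-neighbor of $u$. A symmetric edge is a pair of vertices $u,v$ with both $uv$ and $vu$ edges. Two vertices are equivalent if they have the same in-neighbors and the same out-neighbors. An orientation of $\overrightarrow{G}$ is the digraph on the same vertex set obtained by keeping all non-symmetric edges and retaining exactly one of $uv, vu$ for each symmetric edge. The underlying undirected graph of a digraph has the same vertex set and an undirected edge $\{u,v\}$ whenever $uv$ or $vu$ is a directed edge. In a bipartite graph with color classes $U,W$, a biclique is (the subgraph induced on) a set $T\cup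 Z$ with $T\subseteq U$, $Z\subseteq W$ such that every vertex of $T$ is adjacent to every vertex of $Z$. -}

module Defs where

open import Data.Bool using (Bool; true; false)
open import Data.Nat using (ℕ)
open import Data.Fin using (Fin)
open import Data.Product using (Σ; ∃; _×_; _,_; proj₁)
open import Data.Sum using (_⊎_)
open import Data.Empty using (⊥)
open import Relation.Nullary using (¬_)
open import Relation.Binary.PropositionalEquality using (_≡_; _≢_)

-- Using a
-- Boolean-valued relation excludes parallel edges by construction.
Edge : {V : Set} → (V → V → Bool) → V → V → Set
Edge E u v = E u v ≡ true

Sym : {V : Set} → (V → V → Bool) → V → V → Set
Sym E u v = Edge E u v × Edge E v u

_⇔'_ : Set → Set → Set
A ⇔' B = (A → B) × (B → A)

Equivalent : {V : Set} → (V → V → Bool) → V → V → Set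
Equivalent {V} E u v = (x : V) → (Edge E x u ⇔' Edge E x v) × (Edge E u x ⇔' Edge E v x)

record Is2qBMG {V : Set} (col : V → Bool) (E : V → V → Bool) : Set where
  field
    bipartite : (u v : V) → Edge E u v → col u ≢ col v
    noLoops   : (u : V) → ¬ Edge E u u
    N1 : (u v w t : V) → u ≢ v → ¬ Edge E u v → ¬ Edge E v u →
         Edge E u t → Edge E v w → Edge E t w → ⊥
    N2 : (u v w t : V) → Edge E u v → Edge E v w → Edge E w t → Edge E u t
    N3 : (u v : V) → (∃ λ w → Edge E u w × Edge E v w) →
         ((x : V) → Edge E u x → Edge E v x) ⊎ ((x : V) → Edge E v x → Edge E u x)

NoAdjacentSymEdges : {n : ℕ} → (Fin n → Fin n → Bool) → Set
NoAdjacentSymEdges {n} E = (u v w : Fin n) → Sym E u v → Sym E u w → v ≡ w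

NoEquivalentVertices : {n : ℕ} → (Fin n → Fin n → Bool) → Set
NoEquivalentVertices {n} E = (u v : Fin n) → u ≢ v → ¬ Equivalent E u v

IsOrientation : {n : ℕ} → (E O : Fin n → Fin n → Bool) → Set
IsOrientation {n} E O =
  ((u v : Fin n) → Edge O u v → Edge E u v) ×
  ((u v : Fin n) → Edge E u v → ¬ Edge E v u → Edge O u v) ×
  ((u v : Fin n) → Sym E u v → (Edge O u v ⊎ Edge O v u) × ¬ (Edge O u v × Edge O v u))

Sub : {n : ℕ} → (Fin n → Bool) → Set
Sub {n} S = Σ (Fin n) (λ v → S v ≡ true)

restrictCol : {n : ℕ} (S : Fin n → Bool) → (Fin n → Bool) → Sub S → Bool
restrictCol S col x = col (proj₁ x)

induced : {n : ℕ} (S : Fin n → Bool) → (Fin n → Fin n → Bool) → Sub S → Sub S → Bool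
induced S E x y = E (proj₁ x) (proj₁ y)

-- The underlying undirected graph of the subgraph of O induced on S is a
-- biclique of the underlying undirected graph of E: every two vertices of S
-- of different colours are adjacent in the underlying graph.
-- (The underlying graph of an orientation coincides with that of E.)
IsBicliqueOn : {n : ℕ} → (col : Fin n → Bool) → (E O : Fin n → Fin n → Bool) →
               (S : Fin n → Bool) → Set
IsBicliqueOn {n} col E O S =
  (u v : Fin n) → S u ≡ true → S v ≡ true → col u ≢ col v →
  Edge O u v ⊎ Edge O v u

module Submission where

open import Defs
open import Data.Bool using (Bool; true)
open import Data.Bool.Properties using (_≟_)
open import Data.Nat using (ℕ)
open import Data.Fin using (Fin)
open import Data.Product using (_,_; proj₁; proj₂)
open import Data.Product.Properties using (Σ-≡,≡→≡)
open import Data.Sum using (_⊎_; inj₁; inj₂; [_,_]′)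
open import Function using (_∘_)
open import Function.Definitions using (Injective)
open import Relation.Nullary using (¬_)
open import Relation.Binary.PropositionalEquality using (_≡_)
open import Axiom.UniquenessOfIdentityProofs using (module Decidable⇒UIP)

-- Idea: inside S no edge of G is symmetric, so the orientation keeps every
-- edge of G there and Δ is just the subgraph of G induced on S; and the
-- axioms of a 2-qBMG are inherited by induced subgraphs.

Is2qBMG-respects : {V : Set} {col : V → Bool} {E F : V → V → Bool} →
  ((u v : V) → Edge E u v ⇔' Edge F u v) →
  Is2qBMG col E → Is2qBMG col F
Is2qBMG-respects {E = E} {F} E⇔F G = record
  { bipartite = λ u v → bipartite u v ∘ from
  ; noLoops   = λ u → noLoops u ∘ from
  ; N1        = λ u v w t u≢v ¬uv ¬vu ut vw tw →
      N1 u v w t u≢v (¬uv ∘ to) (¬vu ∘ to) (from ut) (from vw) (from tw)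
  ; N2        = λ u v w t uv vw wt → to (N2 u v w t (from uv) (from vw) (from wt))
  ; N3        = λ u v (w , uw , vw) →
      [ (λ ⊆ → inj₁ λ x → to ∘ ⊆ x ∘ from) , (λ ⊇ → inj₂ λ x → to ∘ ⊇ x ∘ from) ]′
        (N3 u v (w , from uw , from vw))
  }
  where
  open Is2qBMG G
  to : ∀ {u v} → Edge E u v → Edge F u v
  to = proj₁ (E⇔F _ _)
  from : ∀ {u v} → Edge F u v → Edge E u v
  from = proj₂ (E⇔F _ _)

Is2qBMG-pullback : {V W : Set} {col : V → Bool} {E : V → V → Bool} →
  (f : W → V) → Injective _≡_ _≡_ f →
  Is2qBMG col E → Is2qBMG (col ∘ f) (λ x y → E (f x) (f y))
Is2qBMG-pullback f f-inj G = record
  { bipartite = λ u v → bipartite (f u) (f v)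
  ; noLoops   = noLoops ∘ f
  ; N1        = λ u v w t u≢v → N1 (f u) (f v) (f w) (f t) (u≢v ∘ f-inj)
  ; N2        = λ u v w t → N2 (f u) (f v) (f w) (f t)
  ; N3        = λ u v (w , uw , vw) →
      [ (λ ⊆ → inj₁ (⊆ ∘ f)) , (λ ⊇ → inj₂ (⊇ ∘ f)) ]′ (N3 (f u) (f v) (f w , uw , vw))
  }
  where open Is2qBMG G

proj₁-injective : {n : ℕ} {S : Fin n → Bool} → Injective _≡_ _≡_ (proj₁ {B = λ v → S v ≡ true})
proj₁-injective {y = y} eq =
  Σ-≡,≡→≡ (eq , Decidable⇒UIP.≡-irrelevant _≟_ _ (proj₂ y))

orientation-keeps-nonsymmetric : {n : ℕ} {E O : Fin n → Fin n → Bool} →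
  IsOrientation E O → (u v : Fin n) → ¬ Sym E u v → Edge E u v ⇔' Edge O u v
orientation-keeps-nonsymmetric (O⊆E , keep , _) u v ¬sym =
  (λ uv → keep u v uv (λ vu → ¬sym (uv , vu))) , O⊆E u v

proposition4p3 : (n : ℕ) (col : Fin n → Bool) (E : Fin n → Fin n → Bool) →
    Is2qBMG col E →
    (NoAdjacentSymEdges E ⊎ NoEquivalentVertices E) →
    (O : Fin n → Fin n → Bool) → IsOrientation E O →
    (S : Fin n → Bool) → IsBicliqueOn col E O S →
    ((u v : Fin n) → S u ≡ true → S v ≡ true → ¬ Sym E u v) →
    Is2qBMG (restrictCol S col) (induced S O)
proposition4p3 n col E G _ O orientation S _ noSymInS =
  Is2qBMG-respects O-agrees-on-S (Is2qBMG-pullback proj₁ proj₁-injective G)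
  where
  O-agrees-on-S : (x y : Sub S) → Edge (induced S E) x y ⇔' Edge (induced S O) x y
  O-agrees-on-S (u , u∈S) (v , v∈S) =
    orientation-keeps-nonsymmetric orientation u v (noSymInS u v u∈S v∈S)
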